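{- Suppose $N>2$ and $G$ is a strongly $(N-1)$-undetermined impartial game. Then $G+H$ is undetermined for every impartial game $H$.
   Context: All games are short impartial games (identified with the finite set of their options, no infinite runs); $+$ is the disjunctive sum. There are $N$ players moving cyclically; under normal play the player unable to move on their turn is the unique loser. Relative to a position the players are $\mathbf N=\mathbf O_0,\mathbf O_1,\dots,\mathbf O_{N-2},\mathbf P=\mathbf O_{N-1}$ ($\mathbf O_i$ moves $i$ turns after $\mathbf N$), and the outcome $o(G)$ is defined recursively: $\mathbf N\in o(G)$ iff some option $G'$ has $\mathbf P\in o(G')$; for $1\le i\le N-1$, $\mathbf O_i\in o(G)$ iff every option $G'$ has $\mathbf O_{i-1}\in o(G')$. A game $G$ is undetermined if $o(G)=\emptyset$. $G$ is $1$-undetermined if it is undetermined, and for $k>1$, $G$ is $k$-undetermined if it is undetermined and has an option that is $(k-1)$-undetermined. For $k>1$, $G$ is strongly $k$-undetermined if $G$ has at least one option and every option of $G$ is $(k-1)$-undetermined. -}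

module Defs where

open import Data.Nat using (ℕ; zero; suc)
open import Data.Fin using (Fin; zero; suc; fromℕ; inject₁)
open import Data.List using (List; []; _∷_; _++_)
open import Data.List.Relation.Unary.Any using (Any)
open import Data.List.Relation.Unary.All using (All)
open import Data.Empty using (⊥)
open import Data.Unit using (⊤)
open import Data.Sum using (_⊎_)
open import Data.Product using (_×_)
open import Relation.Nullary using (¬_)

data Game : Set where
  node : List Game → Game

options : Game → List Game
options (node gs) = gs

mutual
  _+_ : Game → Game → Game
  node gs + node hs = node (leftOpts gs (node hs) ++ rightOpts (node gs) hs)

  leftOpts : List Game → Game → List Game
  leftOpts [] h = []
  leftOpts (g ∷ gs) h = (g + h) ∷ leftOpts gs h

  rightOpts : Game → List Game → List Game
  rightOpts g [] = []
  rightOpts g (h ∷ hs) = (g + h) ∷ rightOpts g hs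

-- Outcomes for N = suc n players.  Players are indexed by Fin (suc n):
-- zero = 𝐍 = 𝐎₀, index i = 𝐎ᵢ, fromℕ n = 𝐏 = 𝐎_{N-1}.
-- InO n i G  means  𝐎ᵢ ∈ o(G).
mutual
  InO : (n : ℕ) → Fin (suc n) → Game → Set
  InO n zero    (node gs) = SomeP n gs
  InO n (suc j) (node gs) = AllO n (inject₁ j) gs

  SomeP : (n : ℕ) → List Game → Set
  SomeP n []       = ⊥
  SomeP n (g ∷ gs) = InO n (fromℕ n) g ⊎ SomeP n gs

  AllO : (n : ℕ) → Fin (suc n) → List Game → Set
  AllO n i []       = ⊤
  AllO n i (g ∷ gs) = InO n i g × AllO n i gs

Undetermined : ℕ → Game → Set
Undetermined n G = (i : Fin (suc n)) → ¬ InO n i G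

-- k-undetermined (k ≥ 1); for k = 0 the notion is not defined, we set it to ⊥.
KUndetermined : ℕ → ℕ → Game → Set
KUndetermined n zero          G = ⊥
KUndetermined n (suc zero)    G = Undetermined n G
KUndetermined n (suc (suc k)) G =
  Undetermined n G × Any (KUndetermined n (suc k)) (options G)

NonEmpty : List Game → Set
NonEmpty []      = ⊥
NonEmpty (_ ∷ _) = ⊤

StronglyKUndetermined : ℕ → ℕ → Game → Set
StronglyKUndetermined n zero          G = ⊥
StronglyKUndetermined n (suc zero)    G = ⊥
StronglyKUndetermined n (suc (suc k)) G =
  NonEmpty (options G) × All (KUndetermined n (suc k)) (options G)

-- The argument then rests on three general facts:
--   * splitting: if 𝐎_{a+b} ∈ o(G + H) then 𝐎_a ∈ o(G) or 𝐎_b ∈ o(H);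
--   * no game has every player 𝐎₀,…,𝐎ₙ in its outcome;
--   * hence if g is undetermined, 𝐏 ∉ o(g + H) for every H (split n = (n-b)+b).
-- By induction on H, a game G with at least one option, all of them
-- undetermined, has G + H undetermined: 𝐍 cannot move to a 𝐏-position
-- (left options g + H by the third fact, right options G + h by induction),
-- and 𝐎_{j+1} fails because some option G + h or g + 0 lacks 𝐎ⱼ.
-- The theorem follows since for N > 2 every option of a strongly
-- (N-1)-undetermined game is (N-2)-undetermined, hence undetermined.
module Submission where

open import Defs
open import Data.Nat using (ℕ; zero; suc; _<_; _≤_; _∸_; z≤n; s≤s) renaming (_+_ to _+ℕ_)
open import Data.Nat.Properties using (_≟_; ≤-refl; +-identityʳ; m∸n+n≡m; m∸n≤m; <⇒≤; ≤∧≢⇒<)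
import Data.Fin as Fin
open import Data.Fin using (Fin; toℕ; fromℕ; inject₁; fromℕ<)
open import Data.Fin.Properties using (toℕ-fromℕ; toℕ-inject₁; toℕ-fromℕ<; toℕ≤pred[n])
open import Data.List using (List; []; _∷_; _++_)
open import Data.List.Relation.Unary.All as All using (All; _∷_)
open import Data.Empty using (⊥; ⊥-elim)
open import Data.Unit using (⊤; tt)
open import Data.Sum using (_⊎_; inj₁; inj₂)
open import Data.Product using (_×_; _,_; proj₁; proj₂)
open import Function using (id)
open import Relation.Nullary using (¬_; Dec; yes; no)
open import Relation.Nullary.Decidable using (_⊎-dec_; _×-dec_)
open import Relation.Binary.PropositionalEquality
  using (_≡_; refl; sym; trans; cong; cong₂; subst)

module Outcomes (n : ℕ) where

  mutual
    Out : ℕ → Game → Set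
    Out zero    (node gs) = OutSome gs
    Out (suc j) (node gs) = OutAll j gs

    OutSome : List Game → Set
    OutSome []       = ⊥
    OutSome (g ∷ gs) = Out n g ⊎ OutSome gs

    OutAll : ℕ → List Game → Set
    OutAll j []       = ⊤
    OutAll j (g ∷ gs) = Out j g × OutAll j gs

  mutual
    inO≡Out : ∀ i G → InO n i G ≡ Out (toℕ i) G
    inO≡Out Fin.zero    (node gs) = someP≡OutSome gs
    inO≡Out (Fin.suc j) (node gs) = allO≡OutAll j gs

    someP≡OutSome : ∀ gs → SomeP n gs ≡ OutSome gs
    someP≡OutSome []       = refl
    someP≡OutSome (g ∷ gs) = cong₂ _⊎_
      (trans (inO≡Out (fromℕ n) g) (cong (λ k → Out k g) (toℕ-fromℕ n)))
      (someP≡OutSome gs)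

    allO≡OutAll : ∀ j gs → AllO n (inject₁ j) gs ≡ OutAll (toℕ j) gs
    allO≡OutAll j []       = refl
    allO≡OutAll j (g ∷ gs) = cong₂ _×_
      (trans (inO≡Out (inject₁ j) g) (cong (λ k → Out k g) (toℕ-inject₁ j)))
      (allO≡OutAll j gs)

  Undeterminedℕ : Game → Set
  Undeterminedℕ G = ∀ j → j ≤ n → ¬ Out j G

  undetermined⇒ℕ : ∀ {G} → Undetermined n G → Undeterminedℕ G
  undetermined⇒ℕ {G} u j j≤n o = u i (subst id (sym inO≡Outⱼ) o)
    where
    i : Fin (suc n)
    i = fromℕ< (s≤s j≤n)
    inO≡Outⱼ : InO n i G ≡ Out j G
    inO≡Outⱼ = trans (inO≡Out i G) (cong (λ k → Out k G) (toℕ-fromℕ< (s≤s j≤n)))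

  ℕ⇒undetermined : ∀ {G} → Undeterminedℕ G → Undetermined n G
  ℕ⇒undetermined {G} u i o = u (toℕ i) (toℕ≤pred[n] i) (subst id (inO≡Out i G) o)

  -- Outcome membership is decidable (a finite game tree is fully evaluated);
  -- the splitting lemma needs a case distinction on it.
  mutual
    out? : ∀ j G → Dec (Out j G)
    out? zero    (node gs) = outSome? gs
    out? (suc j) (node gs) = outAll? j gs

    outSome? : ∀ gs → Dec (OutSome gs)
    outSome? []       = no λ ()
    outSome? (g ∷ gs) = out? n g ⊎-dec outSome? gs

    outAll? : ∀ j gs → Dec (OutAll j gs)
    outAll? j []       = yes tt
    outAll? j (g ∷ gs) = out? j g ×-dec outAll? j gs

  outSome-++⁻ : ∀ xs ys → OutSome (xs ++ ys) → OutSome xs ⊎ OutSome ys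
  outSome-++⁻ []       ys o        = inj₂ o
  outSome-++⁻ (x ∷ xs) ys (inj₁ o) = inj₁ (inj₁ o)
  outSome-++⁻ (x ∷ xs) ys (inj₂ o) with outSome-++⁻ xs ys o
  ... | inj₁ o′ = inj₁ (inj₂ o′)
  ... | inj₂ o′ = inj₂ o′

  outAll-++⁻ : ∀ j xs ys → OutAll j (xs ++ ys) → OutAll j xs × OutAll j ys
  outAll-++⁻ j []       ys os       = tt , os
  outAll-++⁻ j (x ∷ xs) ys (o , os) =
    let (l , r) = outAll-++⁻ j xs ys os in (o , l) , r

  mutual
    split : ∀ a b G H → Out (a +ℕ b) (G + H) → Out a G ⊎ Out b H
    split zero zero (node gs) (node hs) o
      with outSome-++⁻ (leftOpts gs (node hs)) (rightOpts (node gs) hs) o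
    ... | inj₁ oˡ = splitSomeLeft gs (node hs) oˡ
    ... | inj₂ oʳ = splitSomeRight (node gs) hs oʳ
    split (suc a) b (node gs) (node hs) o with out? b (node hs)
    ... | yes oH = inj₂ oH
    ... | no ¬oH = inj₁ (splitAllLeft a b gs (node hs) ¬oH
      (proj₁ (outAll-++⁻ (a +ℕ b) (leftOpts gs (node hs)) (rightOpts (node gs) hs) o)))
    split zero (suc b) (node gs) (node hs) o with out? zero (node gs)
    ... | yes oG = inj₁ oG
    ... | no ¬oG = inj₂ (splitAllRight b (node gs) hs ¬oG
      (proj₂ (outAll-++⁻ b (leftOpts gs (node hs)) (rightOpts (node gs) hs) o)))

    splitSomeLeft : ∀ gs H → OutSome (leftOpts gs H) → OutSome gs ⊎ Out zero H
    splitSomeLeft (g ∷ gs) H (inj₁ o)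
      with split n zero g H (subst (λ k → Out k (g + H)) (sym (+-identityʳ n)) o)
    ... | inj₁ og = inj₁ (inj₁ og)
    ... | inj₂ oH = inj₂ oH
    splitSomeLeft (g ∷ gs) H (inj₂ o) with splitSomeLeft gs H o
    ... | inj₁ ogs = inj₁ (inj₂ ogs)
    ... | inj₂ oH  = inj₂ oH

    splitSomeRight : ∀ G hs → OutSome (rightOpts G hs) → Out zero G ⊎ OutSome hs
    splitSomeRight G (h ∷ hs) (inj₁ o) with split zero n G h o
    ... | inj₁ oG = inj₁ oG
    ... | inj₂ oh = inj₂ (inj₁ oh)
    splitSomeRight G (h ∷ hs) (inj₂ o) with splitSomeRight G hs o
    ... | inj₁ oG  = inj₁ oG
    ... | inj₂ ohs = inj₂ (inj₂ ohs)

    splitAllLeft : ∀ a b gs H → ¬ Out b H → OutAll (a +ℕ b) (leftOpts gs H) → OutAll a gs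
    splitAllLeft a b []       H ¬oH tt       = tt
    splitAllLeft a b (g ∷ gs) H ¬oH (o , os) with split a b g H o
    ... | inj₁ og = og , splitAllLeft a b gs H ¬oH os
    ... | inj₂ oH = ⊥-elim (¬oH oH)

    splitAllRight : ∀ b G hs → ¬ Out zero G → OutAll b (rightOpts G hs) → OutAll b hs
    splitAllRight b G []       ¬oG tt       = tt
    splitAllRight b G (h ∷ hs) ¬oG (o , os) with split zero b G h o
    ... | inj₁ oG = ⊥-elim (¬oG oG)
    ... | inj₂ oh = oh , splitAllRight b G hs ¬oG os

  -- No game has all of 𝐎₀,…,𝐎ₙ in its outcome: the 𝐏-option that witnesses
  -- 𝐍 ∈ o(H) would inherit 𝐎₀,…,𝐎_{n-1} from H, and so on down the tree.
  mutual
    ¬allOutcomes : ∀ H → ¬ (∀ j → j ≤ n → Out j H)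
    ¬allOutcomes (node hs) all =
      ¬allOutcomesSome hs (λ j j<n → all (suc j) j<n) (all zero z≤n)

    ¬allOutcomesSome : ∀ hs → (∀ j → j < n → OutAll j hs) → ¬ OutSome hs
    ¬allOutcomesSome (h ∷ hs) below (inj₁ oP) = ¬allOutcomes h allₕ
      where
      allₕ : ∀ j → j ≤ n → Out j h
      allₕ j j≤n with j ≟ n
      ... | yes refl = oP
      ... | no j≢n   = proj₁ (below j (≤∧≢⇒< j≤n j≢n))
    ¬allOutcomesSome (h ∷ hs) below (inj₂ o) =
      ¬allOutcomesSome hs (λ j j<n → proj₂ (below j j<n)) o

  -- If g is undetermined then 𝐏 ∉ o(g + H): writing n = (n - b) + b, the
  -- splitting lemma would give 𝐎_b ∈ o(H) for every b ≤ n.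
  undetermined⇒¬P : ∀ g H → Undeterminedℕ g → ¬ Out n (g + H)
  undetermined⇒¬P g H u oP = ¬allOutcomes H allH
    where
    allH : ∀ b → b ≤ n → Out b H
    allH b b≤n
      with split (n ∸ b) b g H (subst (λ k → Out k (g + H)) (sym (m∸n+n≡m b≤n)) oP)
    ... | inj₁ og = ⊥-elim (u (n ∸ b) (m∸n≤m n b) og)
    ... | inj₂ oH = oH

  -- Main induction on H, for G = node gs with gs nonempty and all undetermined.
  -- 𝐍: neither a left option g + H nor a right option G + h is a 𝐏-position.
  -- 𝐎_{j+1}: some option lacks 𝐎ⱼ — the option G + h if H has an option h,
  -- otherwise g + 0 for an option g of G (here nonemptiness is used).
  undeterminedSum : ∀ gs → NonEmpty gs → All Undeterminedℕ gs →
    ∀ H → Undeterminedℕ (node gs + H)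
  undeterminedSum gs ne us (node hs) zero _ o
    with outSome-++⁻ (leftOpts gs (node hs)) (rightOpts (node gs) hs) o
  ... | inj₁ oˡ = noLeftP gs us oˡ
    where
    noLeftP : ∀ gs′ → All Undeterminedℕ gs′ → ¬ OutSome (leftOpts gs′ (node hs))
    noLeftP (g ∷ _)   (u ∷ _)  (inj₁ oP) = undetermined⇒¬P g (node hs) u oP
    noLeftP (_ ∷ gs′) (_ ∷ us′) (inj₂ o′) = noLeftP gs′ us′ o′
  ... | inj₂ oʳ = noRightP hs oʳ
    where
    noRightP : ∀ hs′ → ¬ OutSome (rightOpts (node gs) hs′)
    noRightP (h ∷ _)   (inj₁ oP) = undeterminedSum gs ne us h n ≤-refl oP
    noRightP (_ ∷ hs′) (inj₂ o′) = noRightP hs′ o′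
  undeterminedSum gs ne us (node (h ∷ hs)) (suc j) j<n o =
    undeterminedSum gs ne us h j (<⇒≤ j<n)
      (proj₁ (proj₂ (outAll-++⁻ j (leftOpts gs (node (h ∷ hs)))
                                  (rightOpts (node gs) (h ∷ hs)) o)))
  undeterminedSum (g ∷ gs) _ (u ∷ _) (node []) (suc j) j<n o
    with split j zero g (node [])
      (subst (λ k → Out k (g + node [])) (sym (+-identityʳ j))
        (proj₁ (proj₁ (outAll-++⁻ j (leftOpts (g ∷ gs) (node [])) [] o))))
  ... | inj₁ og = u j (<⇒≤ j<n) og
  ... | inj₂ ()

optionsUndetermined⇒sumUndetermined : ∀ n G → NonEmpty (options G) →
  All (Undetermined n) (options G) → ∀ H → Undetermined n (G + H)
optionsUndetermined⇒sumUndetermined n (node gs) ne us H =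
  ℕ⇒undetermined (undeterminedSum gs ne (All.map undetermined⇒ℕ us) H)
  where open Outcomes n

kUndetermined⇒undetermined : ∀ n k G → KUndetermined n (suc k) G → Undetermined n G
kUndetermined⇒undetermined n zero    G u = u
kUndetermined⇒undetermined n (suc k) G u = proj₁ u

mainTheorem10 : (n : ℕ) → 2 < suc n → (G : Game) →
    StronglyKUndetermined n n G → (H : Game) → Undetermined n (G + H)
mainTheorem10 (suc (suc m)) _ G (ne , us) =
  optionsUndetermined⇒sumUndetermined (suc (suc m)) G ne
    (All.map (kUndetermined⇒undetermined (suc (suc m)) m _) us)
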